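{- Let $G$ be a finite bipartite graph with no isolated vertices and maximum degree $\Delta(G)$. Let $D^{\text{odd}}(G)$ and $D^{\text{even}}(G)$ be the sets of odd and even vertex degrees occurring in $G$. Then $$\check s(G) \leq \sum_{d \in D^{\text{odd}}(G)} \binom{\lceil \Delta(G)/2\rceil}{(d+1)/2}\,(d+1) + \sum_{d \in D^{\text{even}}(G)} \binom{\lceil \Delta(G)/2\rceil}{d/2}.$$
   Context: For a proper edge coloring $\varphi$ of a graph $G$, the palette of a vertex $v$ is the set of colors on edges incident with $v$. The palette index $\check s(G)$ is the minimum number of distinct palettes over all proper edge colorings of $G$. -}

module Defs where

open import Data.Bool using (Bool; true; false; _∧_; if_then_else_)
open import Data.Bool.Properties using () renaming (_≟_ to _≟ᵇ_)
open import Data.Nat using (ℕ; zero; suc; _+_; _*_; _⊔_; _≤_; _≡ᵇ_; ⌈_/2⌉; ⌊_/2⌋)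
open import Data.Nat.Combinatorics using (_C_)
open import Data.Fin using (Fin)
open import Data.Fin.Properties using () renaming (_≟_ to _≟ᶠ_)
open import Data.List using (List; length; map; filterᵇ; allFin; upTo; foldr; deduplicate)
open import Data.Bool.ListAction using (any)
open import Data.Nat.ListAction using (sum)
open import Data.Vec using (Vec; tabulate)
open import Data.Vec.Properties using (≡-dec)
open import Data.Product using (Σ; ∃; _×_)
open import Relation.Nullary.Decidable using (⌊_⌋)
open import Relation.Binary.PropositionalEquality using (_≡_; _≢_)

record Graph (n : ℕ) : Set where
  field
    adj    : Fin n → Fin n → Bool
    sym    : ∀ u v → adj u v ≡ adj v u
    irrefl : ∀ v → adj v v ≡ false
open Graph public

module _ {n : ℕ} (G : Graph n) where

  Bipartite : Set
  Bipartite = Σ (Fin n → Bool) λ side →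
    ∀ u v → adj G u v ≡ true → side u ≢ side v

  deg : Fin n → ℕ
  deg v = length (filterᵇ (adj G v) (allFin n))

  NoIsolatedVertices : Set
  NoIsolatedVertices = ∀ v → Σ (Fin n) λ u → adj G v u ≡ true

  Δ : ℕ
  Δ = foldr _⊔_ 0 (map deg (allFin n))

  occurs : ℕ → Bool
  occurs d = any (λ v → deg v ≡ᵇ d) (allFin n)

  -- An edge colouring with colours in Fin m: a colour for every ordered pair,
  -- only values on edges matter.
  record ProperEdgeColoring (m : ℕ) : Set where
    field
      col    : Fin n → Fin n → Fin m
      colSym : ∀ u v → adj G u v ≡ true → col u v ≡ col v u
      proper : ∀ u v w → adj G u v ≡ true → adj G u w ≡ true →
               col u v ≡ col u w → v ≡ w
  open ProperEdgeColoring public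

  palette : ∀ {m} → ProperEdgeColoring m → Fin n → Vec Bool m
  palette φ v = tabulate λ c →
    any (λ u → adj G v u ∧ ⌊ col φ v u ≟ᶠ c ⌋) (allFin n)

  numPalettes : ∀ {m} → ProperEdgeColoring m → ℕ
  numPalettes φ = length (deduplicate (≡-dec _≟ᵇ_) (map (palette φ) (allFin n)))

  -- s̆(G) ≤ k : the minimum over proper edge colourings of the number of
  -- distinct palettes is at most k
  PaletteIndex≤ : ℕ → Set
  PaletteIndex≤ k = Σ ℕ λ m → Σ (ProperEdgeColoring m) λ φ → numPalettes φ ≤ k

isOdd : ℕ → Bool
isOdd zero = false
isOdd (suc zero) = true
isOdd (suc (suc d)) = isOdd d

module _ {n : ℕ} (G : Graph n) where

  term : ℕ → ℕ
  term d = if isOdd d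
           then (⌈ Δ G /2⌉ C ⌊ suc d /2⌋) * suc d
           else ⌈ Δ G /2⌉ C ⌊ d /2⌋

  -- sum over d ∈ D^odd(G) ∪ D^even(G) (all degrees 0..Δ occurring in G)
  paletteBound : ℕ
  paletteBound = sum (map (λ d → if occurs G d then term d else 0) (upTo (suc (Δ G))))

module Submission where

-- We colour G with the 2k colours Fin k × Fin 2 so that a vertex of degree d
-- has palette S × Fin 2 with |S| = d/2 if d is even, and S × Fin 2 ∖ {(i₀,b₀)}
-- with |S| = (d+1)/2 and i₀ ∈ S if d is odd.  There are C(k,d/2), resp.
-- C(k,(d+1)/2)·(d+1), such palettes (module Shapes), which gives the bound.
--
-- The colouring comes from Kőnig's theorem (module Multigraph: a bipartite
-- multigraph of maximum degree ≤ k is k-edge-colourable, by induction on the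
-- edges with Kempe-chain exchanges), applied twice (module Construction):
--   1. split every vertex v into ⌈deg v/2⌉ copies of degree ≤ 2 and 2-colour
--      the resulting bipartite graph: this is the parity b ∈ Fin 2 of an edge;
--   2. attach the edges of v of one parity to a copy (v , true) and those of
--      the other parity to (v , false); this bipartite graph has degrees
--      ≤ ⌈deg v/2⌉, and we pad it with k − ⌈deg v/2⌉ dummy edges joining the
--      two copies of v, and k-colour it: this is the colour i ∈ Fin k.
-- At v the dummy colours are missing from both parity classes; a class of the
-- full size ⌈deg v/2⌉ uses exactly the other colours, which forces the shapes
-- above (module AtVertex).

open import Defs hiding (sym)
open import Data.Nat using (ℕ; zero; suc; _+_; _*_; _∸_; _≤_; _<_; z≤n; s≤s; ⌈_/2⌉; ⌊_/2⌋; _⊔_)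
import Data.Nat.Properties as ℕP
open import Data.Fin as F using (Fin; zero; suc; toℕ)
import Data.Fin.Properties as FP
open import Data.List as L using (List; []; _∷_; length; map; filterᵇ; allFin; upTo; _++_; concatMap; lookup; deduplicate)
  renaming (find to first)
import Data.List.Properties as LP
open import Data.Nat.Combinatorics using (_C_; nCk+nC[k+1]≡[n+1]C[k+1])
open import Data.List.Membership.Propositional using (_∈_; _∉_; lose; find)
open import Data.List.Membership.Propositional.Properties
  using (∈-deduplicate⁻; ∈-lookup; ∈-length; ∈-filter⁺; ∈-filter⁻; ∈-concatMap⁺; ∈-concatMap⁻; ∈-upTo⁺; ∈-upTo⁻;
         ∈-cartesianProduct⁺; ∈-map⁺; ∈-map⁻; ∈-++⁺ˡ; ∈-++⁺ʳ; ∈-++⁻; ∈-allFin)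
open import Data.List.Membership.DecPropositional as DecMem using ()
open import Data.List.Relation.Unary.Any as Any using (Any; here; there)
open import Data.List.Relation.Unary.Any.Properties using (lookup-index; any⁺; any⁻)
open import Data.Bool using (Bool; true; false; _∧_; if_then_else_; not)
open import Data.Bool.Properties using (T-≡)
import Data.Bool.Properties as BP
open import Data.Bool.ListAction using (any)
open import Data.Nat.ListAction using (sum)
open import Data.Vec as V using (Vec; []; _∷_)
import Data.Vec.Properties as VP
open import Data.Fin.Subset using (Subset; ∣_∣; inside; outside)
open import Data.List.Relation.Unary.All as All using (All)
open import Data.List.Relation.Unary.AllPairs as AllPairs using (_∷_)
import Data.List.Relation.Unary.Unique.Propositional.Properties as UP
import Data.List.Relation.Unary.Unique.DecPropositional.Properties as UDP
open import Data.List.Relation.Binary.Disjoint.Propositional using (Disjoint)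
open import Data.List.Membership.Setoid.Properties using (∉⇒All[≉])
open import Data.List.Relation.Unary.Unique.Propositional using (Unique)
open import Function.Bundles using (Equivalence)
open import Data.Maybe as M using (Maybe; just; nothing; _>>=_)
import Data.Maybe.Properties as MP
open import Data.Maybe.Properties using (just-injective)
open import Data.Product using (_×_; _,_; proj₁; proj₂; ∃)
import Data.Product.Properties as PP
import Data.Sum.Properties as SP
open import Data.Sum using (_⊎_; inj₁; inj₂)
open import Data.Empty using (⊥; ⊥-elim)
open import Function using (_∘_; id)
open import Relation.Nullary using (Dec; yes; no; ¬_; does)
open import Relation.Nullary.Decidable
  using (⌊_⌋; isYes≗does; T?; _×-dec_; _⊎-dec_; ¬?; decidable-stable; dec-true; dec-false)
open import Level using (0ℓ)
open import Relation.Unary using (Pred; Decidable)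
open import Relation.Binary.PropositionalEquality
open import Relation.Binary.Definitions using (DecidableEquality)

∧-trueˡ : ∀ {a b} → a ∧ b ≡ true → a ≡ true
∧-trueˡ {true} _ = refl

∧-trueʳ : ∀ {a b} → a ∧ b ≡ true → b ≡ true
∧-trueʳ {true} b≡true = b≡true

∧-true : ∀ {a b} → a ≡ true → b ≡ true → a ∧ b ≡ true
∧-true refl refl = refl

does-true : ∀ {A : Set} (a? : Dec A) → does a? ≡ true → A
does-true (yes a) _ = a

bool-ext : ∀ {a b : Bool} → (a ≡ true → b ≡ true) → (b ≡ true → a ≡ true) → a ≡ b
bool-ext {true} {true} _ _ = refl
bool-ext {true} {false} a⇒b _ = sym (a⇒b refl)
bool-ext {false} {true} _ b⇒a = b⇒a refl
bool-ext {false} {false} _ _ = refl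

∈-filterᵇ⁺ : ∀ {A : Set} (p : A → Bool) {xs x} → x ∈ xs → p x ≡ true → x ∈ filterᵇ p xs
∈-filterᵇ⁺ p x∈ px = ∈-filter⁺ (T? ∘ p) x∈ (Equivalence.from T-≡ px)

∈-filterᵇ⁻ : ∀ {A : Set} (p : A → Bool) {xs x} → x ∈ filterᵇ p xs → x ∈ xs × p x ≡ true
∈-filterᵇ⁻ p x∈ = let (x∈xs , px) = ∈-filter⁻ (T? ∘ p) x∈ in x∈xs , Equivalence.to T-≡ px

any-true⁺ : ∀ {A : Set} (p : A → Bool) {xs x} → x ∈ xs → p x ≡ true → any p xs ≡ true
any-true⁺ p x∈ px = Equivalence.to T-≡ (any⁺ p (lose x∈ (Equivalence.from T-≡ px)))

any-true⁻ : ∀ {A : Set} (p : A → Bool) xs → any p xs ≡ true → ∃ λ x → x ∈ xs × p x ≡ true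
any-true⁻ p xs any≡true = let (x , x∈ , px) = find (any⁻ p xs (Equivalence.from T-≡ any≡true)) in
  x , x∈ , Equivalence.to T-≡ px

injection-into-list : ∀ {A : Set} {m} (xs : List A) (f : Fin m → A) → (∀ i → f i ∈ xs) →
                      (∀ {i j} → f i ≡ f j → i ≡ j) → m ≤ length xs
injection-into-list xs f f∈ f-injective = FP.injective⇒≤ {f = λ i → Any.index (f∈ i)} λ {i} {j} eq →
  f-injective (trans (lookup-index (f∈ i)) (trans (cong (lookup xs) eq) (sym (lookup-index (f∈ j)))))

bounded-injection : ∀ {m k} (g : Fin m → ℕ) → (∀ i → g i < k) → (∀ {i j} → g i ≡ g j → i ≡ j) →
                    m ≤ k
bounded-injection g g<k g-injective = FP.injective⇒≤ {f = λ i → F.fromℕ< (g<k i)} λ {i} {j} eq →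
  g-injective (trans (sym (FP.toℕ-fromℕ< (g<k i))) (trans (cong toℕ eq) (FP.toℕ-fromℕ< (g<k j))))

unique-lookup-injective : ∀ {A : Set} {xs : List A} → Unique xs → ∀ i j → lookup xs i ≡ lookup xs j → i ≡ j
unique-lookup-injective (_ ∷ _) zero zero _ = refl
unique-lookup-injective (x∉ ∷ _) zero (suc j) eq = ⊥-elim (All.lookup x∉ (∈-lookup j) eq)
unique-lookup-injective (x∉ ∷ _) (suc i) zero eq = ⊥-elim (All.lookup x∉ (∈-lookup i) (sym eq))
unique-lookup-injective (_ ∷ unique) (suc i) (suc j) eq = cong suc (unique-lookup-injective unique i j eq)

unique-⊆-length : ∀ {A : Set} {xs ys : List A} → Unique xs → (∀ {x} → x ∈ xs → x ∈ ys) →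
                  length xs ≤ length ys
unique-⊆-length {xs = xs} {ys} unique ⊆ys =
  injection-into-list ys (lookup xs) (λ i → ⊆ys (∈-lookup i)) (unique-lookup-injective unique _ _)

unique-bounded : ∀ {A : Set} {xs : List A} {m} (g : A → ℕ) → Unique xs → (∀ {x} → x ∈ xs → g x < m) →
                 (∀ {x y} → x ∈ xs → y ∈ xs → g x ≡ g y → x ≡ y) → length xs ≤ m
unique-bounded {xs = xs} g unique g<m g-injective = bounded-injection (g ∘ lookup xs) (λ i → g<m (∈-lookup i))
  λ {i} {j} eq → unique-lookup-injective unique i j (g-injective (∈-lookup i) (∈-lookup j) eq)

unique-map : ∀ {A B : Set} (f : A → B) {xs} → Unique xs →
             (∀ {x y} → x ∈ xs → y ∈ xs → f x ≡ f y → x ≡ y) → Unique (map f xs)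
unique-map f {[]} _ _ = AllPairs.[]
unique-map f {x ∷ xs} (x∉ ∷ unique) f-injective =
  All.tabulate (λ fy∈ eq → let (y , y∈ , fy≡) = ∈-map⁻ f fy∈ in
                 All.lookup x∉ y∈ (f-injective (here refl) (there y∈) (trans eq fy≡)))
  ∷ unique-map f unique (λ x∈ y∈ → f-injective (there x∈) (there y∈))

unique-full : ∀ {k} {xs : List (Fin k)} → Unique xs → length xs ≡ k → ∀ i → i ∈ xs
unique-full {k} {xs} unique len i with DecMem._∈?_ F._≟_ i xs
... | yes i∈ = i∈
... | no i∉ = ⊥-elim (ℕP.<⇒≢ (subst (length xs <_) (LP.length-tabulate id) longer) len)
  where
    longer : length (i ∷ xs) ≤ length (allFin k)
    longer = unique-⊆-length (∉⇒All[≉] (setoid _) i∉ ∷ unique) (λ {x} _ → ∈-allFin x)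

cover : ∀ {k} {xs ys : List (Fin k)} → Unique xs → Unique ys → Disjoint xs ys →
        length xs + length ys ≡ k → ∀ i → i ∈ xs ⊎ i ∈ ys
cover {xs = xs} {ys} unique-xs unique-ys disjoint total i =
  ∈-++⁻ xs (unique-full (UP.++⁺ unique-xs unique-ys disjoint) (trans (LP.length-++ xs) total) i)

one-more : ∀ {A : Set} (_≟A_ : DecidableEquality A) {xs ys : List A} → Unique xs → Unique ys →
           (∀ {x} → x ∈ ys → x ∈ xs) → length xs ≡ suc (length ys) →
           ∃ λ x₀ → x₀ ∈ xs × x₀ ∉ ys × (∀ {x} → x ∈ xs → x ≢ x₀ → x ∈ ys)
one-more _≟A_ {xs} {ys} unique-xs unique-ys ys⊆xs len with Any.any? (λ x → ¬? (DecMem._∈?_ _≟A_ x ys)) xs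
... | no none = ⊥-elim (ℕP.<-irrefl refl (subst (_≤ length ys) len (unique-⊆-length unique-xs xs⊆ys)))
  where
    xs⊆ys : ∀ {x} → x ∈ xs → x ∈ ys
    xs⊆ys {x} x∈ = decidable-stable (DecMem._∈?_ _≟A_ x ys) (λ x∉ → none (lose x∈ x∉))
... | yes some with find some
...   | x₀ , x₀∈ , x₀∉ = x₀ , x₀∈ , x₀∉ , only
  where
    only : ∀ {x} → x ∈ xs → x ≢ x₀ → x ∈ ys
    only {x} x∈ x≢x₀ = decidable-stable (DecMem._∈?_ _≟A_ x ys) λ x∉ →
      ℕP.<-irrefl refl (subst (_ ≤_) len (unique-⊆-length {xs = x ∷ x₀ ∷ ys}
        ((x≢x₀ All.∷ ∉⇒All[≉] (setoid _) x∉) ∷ ∉⇒All[≉] (setoid _) x₀∉ ∷ unique-ys) two-more⊆))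
      where
        two-more⊆ : ∀ {y} → y ∈ x ∷ x₀ ∷ ys → y ∈ xs
        two-more⊆ (here refl) = x∈
        two-more⊆ (there (here refl)) = x₀∈
        two-more⊆ (there (there y∈)) = ys⊆xs y∈

partition-length : ∀ {A : Set} (g : A → Fin 2) xs →
  length (filterᵇ (λ x → does (g x F.≟ zero)) xs) + length (filterᵇ (λ x → does (g x F.≟ suc zero)) xs)
    ≡ length xs
partition-length g [] = refl
partition-length g (x ∷ xs) with g x
... | zero = cong suc (partition-length g xs)
... | suc zero = trans (ℕP.+-suc _ _) (cong suc (partition-length g xs))

length-concatMap : ∀ {A B : Set} (f : A → List B) xs → length (concatMap f xs) ≡ sum (map (length ∘ f) xs)
length-concatMap f [] = refl
length-concatMap f (x ∷ xs) = trans (LP.length-++ (f x)) (cong (length (f x) +_) (length-concatMap f xs))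

length-concatMap-const : ∀ {A B : Set} (f : A → List B) xs t → (∀ {x} → x ∈ xs → length (f x) ≡ t) →
                         length (concatMap f xs) ≡ length xs * t
length-concatMap-const f [] t _ = refl
length-concatMap-const f (x ∷ xs) t lengths =
  trans (LP.length-++ (f x)) (cong₂ _+_ (lengths (here refl)) (length-concatMap-const f xs t (lengths ∘ there)))

length-filter-tabulate : ∀ {A : Set} {k} (p : A → Bool) (g : Fin k → A) →
                         length (filterᵇ p (L.tabulate g)) ≡ ∣ V.tabulate (p ∘ g) ∣
length-filter-tabulate {k = zero} p g = refl
length-filter-tabulate {k = suc k} p g with p (g zero)
... | true = cong suc (length-filter-tabulate p (g ∘ suc))
... | false = length-filter-tabulate p (g ∘ suc)

member : ∀ {k} → Fin k → List (Fin k) → Bool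
member i xs = does (DecMem._∈?_ F._≟_ i xs)

member⁺ : ∀ {k} {i : Fin k} {xs} → i ∈ xs → member i xs ≡ true
member⁺ {i = i} {xs} i∈ = dec-true (DecMem._∈?_ F._≟_ i xs) i∈

member⁻ : ∀ {k} {i : Fin k} {xs} → member i xs ≡ true → i ∈ xs
member⁻ {i = i} {xs} = does-true (DecMem._∈?_ F._≟_ i xs)

member-∉ : ∀ {k} {i : Fin k} {xs} → i ∉ xs → member i xs ≡ false
member-∉ {i = i} {xs} i∉ = dec-false (DecMem._∈?_ F._≟_ i xs) i∉

indicator : ∀ {k} → List (Fin k) → Subset k
indicator xs = V.tabulate (λ i → member i xs)

indicator-size : ∀ {k} {xs : List (Fin k)} → Unique xs → ∣ indicator xs ∣ ≡ length xs
indicator-size {k} {xs} unique = trans (sym (length-filter-tabulate (λ i → member i xs) id))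
  (ℕP.≤-antisym (unique-⊆-length (UP.filter⁺ _ (UP.allFin⁺ k)) from-filter) (unique-⊆-length unique to-filter))
  where
    from-filter : ∀ {i} → i ∈ filterᵇ (λ i → member i xs) (allFin k) → i ∈ xs
    from-filter i∈ = member⁻ (proj₂ (∈-filterᵇ⁻ _ {xs = allFin k} i∈))
    to-filter : ∀ {i} → i ∈ xs → i ∈ filterᵇ (λ i → member i xs) (allFin k)
    to-filter {i} i∈ = ∈-filterᵇ⁺ _ (∈-allFin i) (member⁺ i∈)

member-⊆ : ∀ {k} {xs ys : List (Fin k)} → (∀ {i} → i ∈ xs → i ∈ ys) →
           ∀ {i} → member i xs ≡ true → member i ys ≡ true
member-⊆ xs⊆ys i∈ = member⁺ (xs⊆ys (member⁻ i∈))

module _ {A : Set} {P : Pred A 0ℓ} (P? : Decidable P) where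

  first-just : ∀ xs {e} → first P? xs ≡ just e → e ∈ xs × P e
  first-just (x ∷ xs) eq with P? x
  first-just (x ∷ xs) refl | yes px = here refl , px
  ... | no _ = let (e∈ , pe) = first-just xs eq in there e∈ , pe

  first-unique : ∀ xs {e} → e ∈ xs → P e → (∀ {e'} → e' ∈ xs → P e' → e' ≡ e) → first P? xs ≡ just e
  first-unique (x ∷ xs) e∈ pe unique with P? x
  ... | yes px = cong just (unique (here refl) px)
  first-unique (x ∷ xs) (here refl) pe unique | no ¬px = ⊥-elim (¬px pe)
  first-unique (x ∷ xs) (there e∈) pe unique | no _ = first-unique xs e∈ pe (λ e'∈ → unique (there e'∈))

module _ {A : Set} (_≟A_ : DecidableEquality A) where

  position : A → List A → ℕ
  position u [] = 0
  position u (x ∷ xs) = if does (u ≟A x) then 0 else suc (position u xs)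

  position-< : ∀ {u xs} → u ∈ xs → position u xs < length xs
  position-< {u} {x ∷ xs} u∈ with u ≟A x
  ... | yes _ = s≤s z≤n
  position-< {u} {x ∷ xs} (here u≡x) | no u≢x = ⊥-elim (u≢x u≡x)
  position-< {u} {x ∷ xs} (there u∈) | no _ = s≤s (position-< u∈)

  position-injective : ∀ {u u' xs} → u ∈ xs → u' ∈ xs → position u xs ≡ position u' xs → u ≡ u'
  position-injective {u} {u'} {x ∷ xs} u∈ u'∈ eq with u ≟A x | u' ≟A x
  ... | yes u≡x | yes u'≡x = trans u≡x (sym u'≡x)
  position-injective (here u≡x) _ _ | no u≢x | _ = ⊥-elim (u≢x u≡x)
  position-injective _ (here u'≡x) _ | _ | no u'≢x = ⊥-elim (u'≢x u'≡x)
  position-injective (there u∈) (there u'∈) eq | no _ | no _ = position-injective u∈ u'∈ (ℕP.suc-injective eq)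

≤-foldr-⊔ : ∀ {x xs} → x ∈ xs → x ≤ L.foldr _⊔_ 0 xs
≤-foldr-⊔ {x} {y ∷ xs} (here refl) = ℕP.m≤m⊔n x _
≤-foldr-⊔ {x} {y ∷ xs} (there x∈) = ℕP.≤-trans (≤-foldr-⊔ x∈) (ℕP.m≤n⊔m y _)

even-half : ∀ d → isOdd d ≡ false → ⌊ d /2⌋ * 2 ≡ d × ⌊ d /2⌋ ≡ ⌈ d /2⌉
even-half zero _ = refl , refl
even-half (suc (suc d)) even = let (double , halves) = even-half d even in
  cong (λ m → suc (suc m)) double , cong suc halves

odd-half : ∀ d → isOdd d ≡ true → ⌊ suc d /2⌋ * 2 ≡ suc d
odd-half (suc zero) _ = refl
odd-half (suc (suc d)) odd = cong (λ m → suc (suc m)) (odd-half d odd)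

twice : ∀ h → h * 2 ≡ h + h
twice h = trans (ℕP.*-comm h 2) (cong (h +_) (ℕP.+-identityʳ h))

split-even : ∀ {a b} h → a ≤ h → b ≤ h → a + b ≡ h * 2 → a ≡ h × b ≡ h
split-even {a} {b} h a≤h b≤h sum = tight a≤h b≤h sum , tight b≤h a≤h (trans (ℕP.+-comm b a) sum)
  where
    tight : ∀ {x y} → x ≤ h → y ≤ h → x + y ≡ h * 2 → x ≡ h
    tight {x} {y} x≤h y≤h x+y = ℕP.≤-antisym x≤h (ℕP.+-cancelʳ-≤ h h x
      (ℕP.≤-trans (ℕP.≤-reflexive (trans (sym (twice h)) (sym x+y))) (ℕP.+-monoʳ-≤ x y≤h)))

split-odd : ∀ {a b} h → a ≤ h → b ≤ h → suc (a + b) ≡ h * 2 →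
            (a ≡ h × suc b ≡ h) ⊎ (b ≡ h × suc a ≡ h)
split-odd {a} {b} h a≤h b≤h sum with ℕP.m≤n⇒m<n∨m≡n a≤h | ℕP.m≤n⇒m<n∨m≡n b≤h
... | inj₂ refl | _ = inj₁ (refl , ℕP.+-cancelˡ-≡ h (suc b) h (trans (ℕP.+-suc h b) (trans sum (twice h))))
... | inj₁ _ | inj₂ refl = inj₂ (refl , ℕP.+-cancelʳ-≡ _ (suc a) _ (trans sum (twice h)))
... | inj₁ a<h | inj₁ b<h =
  ⊥-elim (ℕP.<-irrefl refl (subst (suc (suc (a + b)) ≤_) (sym (trans sum (twice h))) too-big))
  where
    too-big : suc (suc (a + b)) ≤ h + h
    too-big = subst (_≤ h + h) (ℕP.+-suc (suc a) b) (ℕP.+-mono-≤ a<h b<h)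

other : Fin 2 → Fin 2
other zero = suc zero
other (suc zero) = zero

other-≢ : ∀ b → other b ≢ b
other-≢ zero ()
other-≢ (suc zero) ()

fin2-cases : ∀ b b' → b' ≡ b ⊎ b' ≡ other b
fin2-cases zero zero = inj₁ refl
fin2-cases zero (suc zero) = inj₂ refl
fin2-cases (suc zero) zero = inj₂ refl
fin2-cases (suc zero) (suc zero) = inj₁ refl

parity : ℕ → ℕ
parity zero = 0
parity (suc zero) = 1
parity (suc (suc m)) = parity m

parity<2 : ∀ m → parity m < 2
parity<2 zero = s≤s z≤n
parity<2 (suc zero) = s≤s (s≤s z≤n)
parity<2 (suc (suc m)) = parity<2 m

half-parity-injective : ∀ a b → ⌊ a /2⌋ ≡ ⌊ b /2⌋ → parity a ≡ parity b → a ≡ b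
half-parity-injective zero zero _ _ = refl
half-parity-injective (suc zero) (suc zero) _ _ = refl
half-parity-injective (suc (suc a)) (suc (suc b)) halves parities =
  cong (λ m → suc (suc m)) (half-parity-injective a b (ℕP.suc-injective halves) parities)
half-parity-injective zero (suc zero) _ ()
half-parity-injective (suc zero) zero _ ()
half-parity-injective zero (suc (suc b)) () _
half-parity-injective (suc zero) (suc (suc b)) () _
half-parity-injective (suc (suc a)) zero () _
half-parity-injective (suc (suc a)) (suc zero) () _

half-< : ∀ a d → a < d → ⌊ a /2⌋ < ⌈ d /2⌉
half-< zero (suc d) _ = s≤s z≤n
half-< (suc zero) (suc zero) (s≤s ())
half-< (suc zero) (suc (suc d)) _ = s≤s z≤n
half-< (suc (suc a)) (suc (suc d)) (s≤s (s≤s a<d)) = s≤s (half-< a d a<d)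

module Multigraph {E : Set} (_≟E_ : DecidableEquality E) where

  recolour : ∀ {C : Set} → (E → C) → E → C → E → C
  recolour c e₀ γ e = if does (e ≟E e₀) then γ else c e

  recolour-same : ∀ {C : Set} (c : E → C) e₀ γ → recolour c e₀ γ e₀ ≡ γ
  recolour-same c e₀ γ = cong (if_then γ else c e₀) (dec-true (e₀ ≟E e₀) refl)

  recolour-other : ∀ {C : Set} (c : E → C) {e₀} γ {e} → e ≢ e₀ → recolour c e₀ γ e ≡ c e
  recolour-other c {e₀} γ {e} e≢e₀ = cong (if_then γ else c e) (dec-false (e ≟E e₀) e≢e₀)

  -- Notions relative to one endpoint map end : E → V, i.e. one side of a
  -- bipartite multigraph.
  module Side {V : Set} (_≟V_ : DecidableEquality V) (end : E → V) (k : ℕ) where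

    Proper : ∀ {C : Set} → List E → (E → C) → Set
    Proper es c = ∀ {e e'} → e ∈ es → e' ∈ es → end e ≡ end e' → c e ≡ c e' → e ≡ e'

    proper-dup : ∀ {C : Set} {e₀ es} {c : E → C} → e₀ ∈ es → Proper es c → Proper (e₀ ∷ es) c
    proper-dup e₀∈ c-proper (here refl) (here refl) _ _ = refl
    proper-dup e₀∈ c-proper (here refl) (there e'∈) = c-proper e₀∈ e'∈
    proper-dup e₀∈ c-proper (there e∈) (here refl) = c-proper e∈ e₀∈
    proper-dup e₀∈ c-proper (there e∈) (there e'∈) = c-proper e∈ e'∈

    DegreeAtMost : List E → Set
    DegreeAtMost es = ∀ v (f : Fin (suc k) → E) → (∀ i → f i ∈ es) → (∀ i → end (f i) ≡ v) →
                      (∀ {i j} → f i ≡ f j → i ≡ j) → ⊥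

    degree-tail : ∀ {e₀ es} → DegreeAtMost (e₀ ∷ es) → DegreeAtMost es
    degree-tail deg v f f∈ = deg v f (λ i → there (f∈ i))

    labelling⇒degree : ∀ {es} (s : E → ℕ) → (∀ {e} → e ∈ es → s e < k) → Proper es s → DegreeAtMost es
    labelling⇒degree s s<k s-proper v f f∈ f-end f-injective =
      ℕP.<-irrefl refl (bounded-injection (λ i → s (f i)) (λ i → s<k (f∈ i))
        λ eq → f-injective (s-proper (f∈ _) (f∈ _) (trans (f-end _) (sym (f-end _))) eq))

    Present : List E → (E → Fin k) → V → Fin k → Set
    Present es c v γ = Any (λ e → end e ≡ v × c e ≡ γ) es

    present? : ∀ es c v γ → Dec (Present es c v γ)
    present? es c v γ = Any.any? (λ e → (end e ≟V v) ×-dec (c e F.≟ γ)) es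

    Missing : List E → (E → Fin k) → V → Fin k → Set
    Missing es c v γ = ¬ Present es c v γ

    edgeAt : List E → (E → Fin k) → Fin k → V → Maybe E
    edgeAt es c γ v = first (λ e → (end e ≟V v) ×-dec (c e F.≟ γ)) es

    edgeAt-just : ∀ {es c γ v e} → edgeAt es c γ v ≡ just e → e ∈ es × end e ≡ v × c e ≡ γ
    edgeAt-just {es} eq = first-just _ es eq

    edgeAt-complete : ∀ {es c γ v e} → Proper es c → e ∈ es → end e ≡ v → c e ≡ γ →
                      edgeAt es c γ v ≡ just e
    edgeAt-complete {es} c-proper e∈ e-end e-col = first-unique _ es e∈ (e-end , e-col)
      λ e'∈ (e'-end , e'-col) → c-proper e'∈ e∈ (trans e'-end (sym e-end)) (trans e'-col (sym e-col))

    missing-colour : ∀ {es} (c : E → Fin k) {e₀} → e₀ ∉ es → DegreeAtMost (e₀ ∷ es) →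
                     ∃ (Missing es c (end e₀))
    missing-colour {es} c {e₀} e₀∉ deg with FP.any? (λ γ → ¬? (present? es c (end e₀) γ))
    ... | yes missing = missing
    ... | no none = ⊥-elim (deg (end e₀) f f∈ f-end f-injective)
      where
        present : ∀ γ → ∃ λ e → e ∈ es × end e ≡ end e₀ × c e ≡ γ
        present γ = find (decidable-stable (present? es c (end e₀) γ) (λ ¬p → none (γ , ¬p)))
        -- e₀ followed by an edge of every colour at end e₀
        f : Fin (suc k) → E
        f zero = e₀
        f (suc γ) = proj₁ (present γ)
        f∈ : ∀ i → f i ∈ e₀ ∷ es
        f∈ zero = here refl
        f∈ (suc γ) = there (proj₁ (proj₂ (present γ)))
        f-end : ∀ i → end (f i) ≡ end e₀
        f-end zero = refl
        f-end (suc γ) = proj₁ (proj₂ (proj₂ (present γ)))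
        f-colour : ∀ γ → c (f (suc γ)) ≡ γ
        f-colour γ = proj₂ (proj₂ (proj₂ (present γ)))
        f-injective : ∀ {i j} → f i ≡ f j → i ≡ j
        f-injective {zero} {zero} _ = refl
        f-injective {zero} {suc j} eq = ⊥-elim (e₀∉ (subst (_∈ es) (sym eq) (proj₁ (proj₂ (present j)))))
        f-injective {suc i} {zero} eq = ⊥-elim (e₀∉ (subst (_∈ es) eq (proj₁ (proj₂ (present i)))))
        f-injective {suc i} {suc j} eq = cong suc (trans (sym (f-colour i)) (trans (cong c eq) (f-colour j)))

    recolour-proper : ∀ {es c e₀ γ} → Proper es c → e₀ ∉ es → Missing es c (end e₀) γ →
                      Proper (e₀ ∷ es) (recolour c e₀ γ)
    recolour-proper {es} {c} {e₀} {γ} c-proper e₀∉ missing = extended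
      where
        unchanged : ∀ {e} → e ∈ es → recolour c e₀ γ e ≡ c e
        unchanged e∈ = recolour-other c γ λ { refl → e₀∉ e∈ }
        fresh : ∀ {e} → e ∈ es → end e ≡ end e₀ → recolour c e₀ γ e ≢ recolour c e₀ γ e₀
        fresh e∈ e-end eq = missing (lose e∈ (e-end , trans (sym (unchanged e∈)) (trans eq (recolour-same c e₀ γ))))
        extended : Proper (e₀ ∷ es) (recolour c e₀ γ)
        extended (here refl) (here refl) _ _ = refl
        extended (here refl) (there e'∈) same eq = ⊥-elim (fresh e'∈ (sym same) (sym eq))
        extended (there e∈) (here refl) same eq = ⊥-elim (fresh e∈ same eq)
        extended (there e∈) (there e'∈) same eq =
          c-proper e∈ e'∈ same (trans (sym (unchanged e∈)) (trans eq (unchanged e'∈)))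

  module Bipartite {X Y : Set} (_≟X_ : DecidableEquality X) (_≟Y_ : DecidableEquality Y)
                   (src : E → X) (tgt : E → Y) (k : ℕ) where
    module SX = Side _≟X_ src k
    module SY = Side _≟Y_ tgt k

    ProperColouring : List E → (E → Fin k) → Set
    ProperColouring es c = SX.Proper es c × SY.Proper es c

    -- Kempe-chain recolouring.  Let x miss α and y miss β.  Exchanging α and β on
    -- the α/β-alternating path starting at y yields a proper colouring in which
    -- both x and y miss α.
    module Kempe (es : List E) (c : E → Fin k) (c-proper : ProperColouring es c) (α β : Fin k)
                 (x : X) (y : Y) (x-misses-α : SX.Missing es c x α) (y-misses-β : SY.Missing es c y β) where

      properX : SX.Proper es c
      properX = proj₁ c-proper
      properY : SY.Proper es c
      properY = proj₂ c-proper

      -- Y-vertices w₀ = y, w₁, … of the path: from wᵢ take its α-edge aᵢ, then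
      -- the β-edge bᵢ at the X-end of aᵢ; its Y-end is wᵢ₊₁.
      αEdge : Y → Maybe E
      αEdge v = SY.edgeAt es c α v
      βEdge : E → Maybe E
      βEdge e = SX.edgeAt es c β (src e)

      w : ℕ → Maybe Y
      a b : ℕ → Maybe E
      w zero = just y
      w (suc i) = M.map tgt (b i)
      a i = w i >>= αEdge
      b i = a i >>= βEdge

      a-just : ∀ i {e} → a i ≡ just e → w i ≡ just (tgt e) × e ∈ es × c e ≡ α
      a-just i eq with w i
      ... | just v = let (e∈ , e-end , e-col) = SY.edgeAt-just eq in cong just (sym e-end) , e∈ , e-col

      b-just : ∀ i {e} → b i ≡ just e → ∃ λ e₁ → a i ≡ just e₁ × src e ≡ src e₁ × e ∈ es × c e ≡ β
      b-just i eq with a i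
      ... | just e₁ = let (e∈ , e-end , e-col) = SX.edgeAt-just eq in e₁ , refl , e-end , e∈ , e-col

      w-just : ∀ i {v} → w (suc i) ≡ just v → ∃ λ e → b i ≡ just e × tgt e ≡ v
      w-just i eq with b i
      w-just i refl | just e = e , refl , refl

      a-complete : ∀ i {v e} → w i ≡ just v → e ∈ es → tgt e ≡ v → c e ≡ α → a i ≡ just e
      a-complete i wᵢ e∈ e-end e-col rewrite wᵢ = SY.edgeAt-complete properY e∈ e-end e-col

      b-complete : ∀ i {e₁ e} → a i ≡ just e₁ → e ∈ es → src e ≡ src e₁ → c e ≡ β → b i ≡ just e
      b-complete i aᵢ e∈ e-end e-col = trans (cong (_>>= βEdge) aᵢ) (SX.edgeAt-complete properX e∈ e-end e-col)

      -- the Y-vertices of the path are distinct: equal β-edges into wᵢ₊₁ = wⱼ₊₁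
      -- leave from the same X-vertex, hence follow the same α-edge, so wᵢ = wⱼ
      w-injective : ∀ i j {v} → w i ≡ just v → w j ≡ just v → i ≡ j
      w-injective zero zero _ _ = refl
      w-injective zero (suc j) w₀ wⱼ = ⊥-elim (never-back-to-y j (trans wⱼ (sym w₀)))
        where
          never-back-to-y : ∀ j → w (suc j) ≢ just y
          never-back-to-y j eq = let (e , bⱼ , e-end) = w-just j eq ; (_ , _ , _ , e∈ , e-col) = b-just j bⱼ in
            y-misses-β (lose e∈ (e-end , e-col))
      w-injective (suc i) zero wᵢ w₀ = sym (w-injective zero (suc i) w₀ wᵢ)
      w-injective (suc i) (suc j) wᵢ wⱼ =
        let (eᵢ , bᵢ , tᵢ) = w-just i wᵢ ; (aᵢ' , aᵢ , sᵢ , eᵢ∈ , cᵢ) = b-just i bᵢ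
            (eⱼ , bⱼ , tⱼ) = w-just j wⱼ ; (aⱼ' , aⱼ , sⱼ , eⱼ∈ , cⱼ) = b-just j bⱼ
            (wᵢ' , aᵢ'∈ , αᵢ) = a-just i aᵢ ; (wⱼ' , aⱼ'∈ , αⱼ) = a-just j aⱼ
            same-b = properY eᵢ∈ eⱼ∈ (trans tᵢ (sym tⱼ)) (trans cᵢ (sym cⱼ))
            same-a = properX aᵢ'∈ aⱼ'∈ (trans (sym sᵢ) (trans (cong src same-b) sⱼ)) (trans αᵢ (sym αⱼ))
        in cong suc (w-injective i j wᵢ' (trans wⱼ' (cong (just ∘ tgt) (sym same-a))))

      N : ℕ
      N = length es

      a-below : ∀ j i {e} → i ≤ j → a j ≡ just e → ∃ λ e' → a i ≡ just e'
      a-below j i i≤j aⱼ with ℕP.m≤n⇒m<n∨m≡n i≤j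
      ... | inj₂ refl = _ , aⱼ
      a-below (suc j) i i≤j aⱼ | inj₁ i<1+j =
        let (wⱼ , _ , _) = a-just (suc j) aⱼ ; (_ , bⱼ , _) = w-just j wⱼ ; (_ , aⱼ' , _) = b-just j bⱼ
        in a-below j i (ℕP.≤-pred i<1+j) aⱼ'

      -- the path has fewer than N α-edges, as they are distinct edges of es
      path-ends : a N ≡ nothing
      path-ends with a N in aN
      ... | nothing = refl
      ... | just e = ⊥-elim (ℕP.<-irrefl refl (injection-into-list es edge edge∈ edge-injective))
        where
          edge-at : (i : Fin (suc N)) → ∃ λ e' → a (toℕ i) ≡ just e'
          edge-at i = a-below N (toℕ i) (ℕP.≤-pred (FP.toℕ<n i)) aN
          edge : Fin (suc N) → E
          edge i = proj₁ (edge-at i)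
          edge∈ : ∀ i → edge i ∈ es
          edge∈ i = proj₁ (proj₂ (a-just (toℕ i) (proj₂ (edge-at i))))
          edge-injective : ∀ {i j} → edge i ≡ edge j → i ≡ j
          edge-injective {i} {j} eq = FP.toℕ-injective (w-injective (toℕ i) (toℕ j)
            (proj₁ (a-just (toℕ i) (proj₂ (edge-at i))))
            (trans (proj₁ (a-just (toℕ j) (proj₂ (edge-at j)))) (cong (just ∘ tgt) (sym eq))))

      OnPath : E → Set
      OnPath e = ∃ λ i → i < N × (a i ≡ just e ⊎ b i ≡ just e)

      onPath? : ∀ e → Dec (OnPath e)
      onPath? e = ℕP.anyUpTo? (λ i → MP.≡-dec _≟E_ (a i) (just e) ⊎-dec MP.≡-dec _≟E_ (b i) (just e)) N

      AB : Fin k → Set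
      AB γ = γ ≡ α ⊎ γ ≡ β

      onPath-AB : ∀ {e} → OnPath e → AB (c e)
      onPath-AB (i , _ , inj₁ aᵢ) = inj₁ (proj₂ (proj₂ (a-just i aᵢ)))
      onPath-AB (i , _ , inj₂ bᵢ) = inj₂ (proj₂ (proj₂ (proj₂ (proj₂ (b-just i bᵢ)))))

      closedX : ∀ {e e'} → OnPath e → e' ∈ es → AB (c e') → src e ≡ src e' → OnPath e'
      closedX (i , i<N , inj₁ aᵢ) e'∈ (inj₁ α') same = let (_ , e∈ , αₑ) = a-just i aᵢ in
        i , i<N , inj₁ (trans aᵢ (cong just (properX e∈ e'∈ same (trans αₑ (sym α')))))
      closedX (i , i<N , inj₁ aᵢ) e'∈ (inj₂ β') same = i , i<N , inj₂ (b-complete i aᵢ e'∈ (sym same) β')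
      closedX (i , i<N , inj₂ bᵢ) e'∈ (inj₁ α') same =
        let (e₁ , aᵢ , s₁ , _ , _) = b-just i bᵢ ; (_ , e₁∈ , α₁) = a-just i aᵢ in
        i , i<N , inj₁ (trans aᵢ (cong just (properX e₁∈ e'∈ (trans (sym s₁) same) (trans α₁ (sym α')))))
      closedX (i , i<N , inj₂ bᵢ) e'∈ (inj₂ β') same = let (_ , _ , _ , e∈ , βₑ) = b-just i bᵢ in
        i , i<N , inj₂ (trans bᵢ (cong just (properX e∈ e'∈ same (trans βₑ (sym β')))))

      closedY : ∀ {e e'} → OnPath e → e' ∈ es → AB (c e') → tgt e ≡ tgt e' → OnPath e'
      closedY (i , i<N , inj₁ aᵢ) e'∈ (inj₁ α') same = let (_ , e∈ , αₑ) = a-just i aᵢ in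
        i , i<N , inj₁ (trans aᵢ (cong just (properY e∈ e'∈ same (trans αₑ (sym α')))))
      closedY (zero , _ , inj₁ a₀) e'∈ (inj₂ β') same =
        ⊥-elim (y-misses-β (lose e'∈ (trans (sym same) (sym (just-injective (proj₁ (a-just zero a₀)))) , β')))
      closedY (suc i , 1+i<N , inj₁ aᵢ) e'∈ (inj₂ β') same =
        let (wᵢ , _ , _) = a-just (suc i) aᵢ ; (e₂ , bᵢ , t₂) = w-just i wᵢ
            (_ , _ , _ , e₂∈ , β₂) = b-just i bᵢ in
        i , ℕP.<-trans (ℕP.n<1+n i) 1+i<N ,
        inj₂ (trans bᵢ (cong just (properY e₂∈ e'∈ (trans t₂ same) (trans β₂ (sym β')))))
      closedY (i , i<N , inj₂ bᵢ) e'∈ (inj₂ β') same = let (_ , _ , _ , e∈ , βₑ) = b-just i bᵢ in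
        i , i<N , inj₂ (trans bᵢ (cong just (properY e∈ e'∈ same (trans βₑ (sym β')))))
      -- (the α-edge after bᵢ is the step i + 1, which is still below N by path-ends)
      closedY {e' = e'} (i , i<N , inj₂ bᵢ) e'∈ (inj₁ α') same = continue (ℕP.m≤n⇒m<n∨m≡n i<N)
        where
          next : a (suc i) ≡ just e'
          next = a-complete (suc i) (cong (M.map tgt) bᵢ) e'∈ (sym same) α'
          just≢nothing : ∀ {e : E} → just e ≢ nothing
          just≢nothing ()
          continue : suc i < N ⊎ suc i ≡ N → OnPath e'
          continue (inj₁ 1+i<N) = suc i , 1+i<N , inj₁ next
          continue (inj₂ 1+i≡N) =
            ⊥-elim (just≢nothing (trans (sym next) (subst (λ j → a j ≡ nothing) (sym 1+i≡N) path-ends)))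

      -- x is not on the path: X-vertices are entered through α-edges
      x-off-path : ∀ {e} → OnPath e → src e ≢ x
      x-off-path (i , _ , inj₁ aᵢ) at-x = let (_ , e∈ , αₑ) = a-just i aᵢ in x-misses-α (lose e∈ (at-x , αₑ))
      x-off-path (i , _ , inj₂ bᵢ) at-x =
        let (e₁ , aᵢ , s₁ , _ , _) = b-just i bᵢ ; (_ , e₁∈ , α₁) = a-just i aᵢ in
        x-misses-α (lose e₁∈ (trans (sym s₁) at-x , α₁))

      y-α-on-path : ∀ {e} → e ∈ es → tgt e ≡ y → c e ≡ α → OnPath e
      y-α-on-path e∈ e-end αₑ = 0 , ∈-length e∈ , inj₁ (a-complete 0 refl e∈ e-end αₑ)

      exchange : Fin k → Fin k
      exchange γ = if does (γ F.≟ α) then β else α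

      exchange-α : exchange α ≡ β
      exchange-α = cong (if_then β else α) (dec-true (α F.≟ α) refl)

      exchange-β : exchange β ≡ α
      exchange-β with β F.≟ α
      ... | yes β≡α = β≡α
      ... | no _ = refl

      exchange-AB : ∀ γ → AB (exchange γ)
      exchange-AB γ with γ F.≟ α
      ... | yes _ = inj₂ refl
      ... | no _ = inj₁ refl

      exchange-involutive : ∀ {γ} → AB γ → exchange (exchange γ) ≡ γ
      exchange-involutive (inj₁ refl) = trans (cong exchange exchange-α) exchange-β
      exchange-involutive (inj₂ refl) = trans (cong exchange exchange-β) exchange-α

      exchange-injective : ∀ {γ γ'} → AB γ → AB γ' → exchange γ ≡ exchange γ' → γ ≡ γ'
      exchange-injective p p' eq =
        trans (sym (exchange-involutive p)) (trans (cong exchange eq) (exchange-involutive p'))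

      c' : E → Fin k
      c' e = if does (onPath? e) then exchange (c e) else c e

      exchanged-proper : ∀ {V : Set} (end : E → V) →
        (∀ {e e'} → e ∈ es → e' ∈ es → end e ≡ end e' → c e ≡ c e' → e ≡ e') →
        (∀ {e e'} → OnPath e → e' ∈ es → AB (c e') → end e ≡ end e' → OnPath e') →
        ∀ {e e'} → e ∈ es → e' ∈ es → end e ≡ end e' → c' e ≡ c' e' → e ≡ e'
      exchanged-proper end c-ok closed {e} {e'} e∈ e'∈ same eq with onPath? e | onPath? e'
      ... | yes p | yes p' = c-ok e∈ e'∈ same (exchange-injective (onPath-AB p) (onPath-AB p') eq)
      ... | no _  | no _   = c-ok e∈ e'∈ same eq
      ... | yes p | no off = ⊥-elim (off (closed p e'∈ (subst AB eq (exchange-AB (c e))) same))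
      ... | no off | yes p = ⊥-elim (off (closed p e∈ (subst AB (sym eq) (exchange-AB (c e'))) (sym same)))

      c'-proper : ProperColouring es c'
      c'-proper = exchanged-proper src properX closedX , exchanged-proper tgt properY closedY

      x-misses-α' : SX.Missing es c' x α
      x-misses-α' present with find present
      ... | e , e∈ , e-end , e-col with onPath? e
      ...   | yes p = x-off-path p e-end
      ...   | no _ = x-misses-α (lose e∈ (e-end , e-col))

      y-misses-α' : SY.Missing es c' y α
      y-misses-α' present with find present
      ... | e , e∈ , e-end , e-col with onPath? e
      ...   | yes p = y-misses-β (lose e∈ (e-end , was-β))
        where
          was-β : c e ≡ β
          was-β = trans (sym (exchange-involutive (onPath-AB p))) (trans (cong exchange e-col) exchange-α)
      ...   | no off = off (y-α-on-path e∈ e-end e-col)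

    add-edge : ∀ {es c e₀ γ} → ProperColouring es c → e₀ ∉ es → SX.Missing es c (src e₀) γ →
               SY.Missing es c (tgt e₀) γ → ProperColouring (e₀ ∷ es) (recolour c e₀ γ)
    add-edge (properX , properY) e₀∉ missingX missingY =
      SX.recolour-proper properX e₀∉ missingX , SY.recolour-proper properY e₀∉ missingY

    -- Kőnig's theorem: a bipartite multigraph of maximum degree ≤ k has a
    -- proper k-edge-colouring (c₀ is an arbitrary colour, used when es = []).
    -- Each new edge gets a colour α missing at its X-end after a Kempe exchange
    -- has made α missing at its Y-end as well.
    konig : Fin k → ∀ es → SX.DegreeAtMost es → SY.DegreeAtMost es → ∃ (ProperColouring es)
    konig c₀ [] _ _ = (λ _ → c₀) , (λ ()) , (λ ())
    konig c₀ (e₀ ∷ es) degX degY with konig c₀ es (SX.degree-tail degX) (SY.degree-tail degY)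
    ... | c , c-proper with DecMem._∈?_ _≟E_ e₀ es
    ...   | yes e₀∈ = c , SX.proper-dup e₀∈ (proj₁ c-proper) , SY.proper-dup e₀∈ (proj₂ c-proper)
    ...   | no e₀∉ with SX.missing-colour c e₀∉ degX | SY.missing-colour c e₀∉ degY
    ...     | α , x-misses-α | β , y-misses-β =
      recolour K.c' e₀ α , add-edge K.c'-proper e₀∉ K.x-misses-α' K.y-misses-α'
      where module K = Kempe es c c-proper α β (src e₀) (tgt e₀) x-misses-α y-misses-β

subsets : (k j : ℕ) → List (Subset k)
subsets zero zero = [] ∷ []
subsets zero (suc j) = []
subsets (suc k) zero = map (outside ∷_) (subsets k zero)
subsets (suc k) (suc j) = map (outside ∷_) (subsets k (suc j)) ++ map (inside ∷_) (subsets k j)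

subsets-length : ∀ k j → length (subsets k j) ≡ k C j
subsets-length zero zero = refl
subsets-length zero (suc j) = refl
subsets-length (suc k) zero = trans (LP.length-map _ (subsets k zero)) (subsets-length k zero)
subsets-length (suc k) (suc j) = begin
  length (map (outside ∷_) (subsets k (suc j)) ++ map (inside ∷_) (subsets k j))
    ≡⟨ LP.length-++ (map (outside ∷_) (subsets k (suc j))) ⟩
  length (map (outside ∷_) (subsets k (suc j))) + length (map (inside ∷_) (subsets k j))
    ≡⟨ cong₂ _+_ (LP.length-map _ (subsets k (suc j))) (LP.length-map _ (subsets k j)) ⟩
  length (subsets k (suc j)) + length (subsets k j)
    ≡⟨ cong₂ _+_ (subsets-length k (suc j)) (subsets-length k j) ⟩
  k C suc j + k C j
    ≡⟨ ℕP.+-comm (k C suc j) (k C j) ⟩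
  k C j + k C suc j
    ≡⟨ nCk+nC[k+1]≡[n+1]C[k+1] k j ⟩
  suc k C suc j ∎
  where open ≡-Reasoning

subsets-size : ∀ k j {S} → S ∈ subsets k j → ∣ S ∣ ≡ j
subsets-size zero zero (here refl) = refl
subsets-size (suc k) zero S∈ with ∈-map⁻ (outside ∷_) S∈
... | S' , S'∈ , refl = subsets-size k zero S'∈
subsets-size (suc k) (suc j) S∈ with ∈-++⁻ (map (outside ∷_) (subsets k (suc j))) S∈
... | inj₁ S∈out with ∈-map⁻ (outside ∷_) S∈out
...   | S' , S'∈ , refl = subsets-size k (suc j) S'∈
subsets-size (suc k) (suc j) S∈ | inj₂ S∈in with ∈-map⁻ (inside ∷_) S∈in
...   | S' , S'∈ , refl = cong suc (subsets-size k j S'∈)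

subsets-complete : ∀ {k} (S : Subset k) → S ∈ subsets k ∣ S ∣
subsets-complete [] = here refl
subsets-complete (inside ∷ S) =
  ∈-++⁺ʳ (map (outside ∷_) (subsets _ (suc ∣ S ∣))) (∈-map⁺ (inside ∷_) (subsets-complete S))
subsets-complete {suc k} (outside ∷ S) with ∣ S ∣ | subsets-complete S
... | zero | S∈ = ∈-map⁺ (outside ∷_) S∈
... | suc j | S∈ = ∈-++⁺ˡ (∈-map⁺ (outside ∷_) S∈)

-- Palettes over the colours Fin (k * 2) ≅ Fin k × Fin 2, and the palettes
-- that can occur at a vertex of degree d.
module Shapes (k : ℕ) where

  Palette : Set
  Palette = Vec Bool (k * 2)

  split : Fin (k * 2) → Fin k × Fin 2
  split = F.remQuot {k} 2

  shape : (Fin k → Fin 2 → Bool) → Palette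
  shape P = V.tabulate (λ c → P (proj₁ (split c)) (proj₂ (split c)))

  shape-cong : ∀ {P Q} → (∀ i b → P i b ≡ Q i b) → shape P ≡ shape Q
  shape-cong P≡Q = VP.tabulate-cong (λ c → P≡Q _ _)

  evenShape : Subset k → Palette
  evenShape S = shape (λ i _ → V.lookup S i)

  oddShape : Subset k → Fin k → Fin 2 → Palette
  oddShape S i₀ b₀ = shape (λ i b → V.lookup S i ∧ not (does (i F.≟ i₀) ∧ does (b F.≟ b₀)))

  members : Subset k → List (Fin k)
  members S = filterᵇ (V.lookup S) (allFin k)

  members-length : ∀ S → length (members S) ≡ ∣ S ∣
  members-length S = trans (length-filter-tabulate (V.lookup S) id) (cong ∣_∣ (VP.tabulate∘lookup S))

  oddShapesOf : Subset k → List Palette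
  oddShapesOf S = concatMap (λ i → map (oddShape S i) (allFin 2)) (members S)

  candidates : ℕ → List Palette
  candidates d = if isOdd d then concatMap oddShapesOf (subsets k ⌊ suc d /2⌋)
                            else map evenShape (subsets k ⌊ d /2⌋)

  candidates-length : ∀ d → length (candidates d) ≡
                      (if isOdd d then (k C ⌊ suc d /2⌋) * suc d else k C ⌊ d /2⌋)
  candidates-length d with isOdd d in odd
  ... | false = trans (LP.length-map evenShape (subsets k ⌊ d /2⌋)) (subsets-length k ⌊ d /2⌋)
  ... | true = trans (length-concatMap-const oddShapesOf (subsets k j) (j * 2) shapes-length)
                     (cong₂ _*_ (subsets-length k j) (odd-half d odd))
    where
      j : ℕ
      j = ⌊ suc d /2⌋
      shapes-length : ∀ {S} → S ∈ subsets k j → length (oddShapesOf S) ≡ j * 2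
      shapes-length {S} S∈ =
        trans (length-concatMap-const _ (members S) 2 (λ {i} _ → LP.length-map (oddShape S i) (allFin 2)))
              (cong (_* 2) (trans (members-length S) (subsets-size k j S∈)))

  evenShape-candidate : ∀ {d S} → isOdd d ≡ false → ∣ S ∣ ≡ ⌊ d /2⌋ → evenShape S ∈ candidates d
  evenShape-candidate {d} {S} even size rewrite even =
    subst (λ j → evenShape S ∈ map evenShape (subsets k j)) size (∈-map⁺ evenShape (subsets-complete S))

  oddShape-candidate : ∀ {d S i₀} b₀ → isOdd d ≡ true → ∣ S ∣ ≡ ⌊ suc d /2⌋ → V.lookup S i₀ ≡ true →
                       oddShape S i₀ b₀ ∈ candidates d
  oddShape-candidate {d} {S} {i₀} b₀ odd size i₀∈S rewrite odd =
    subst (λ j → oddShape S i₀ b₀ ∈ concatMap oddShapesOf (subsets k j)) size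
      (∈-concatMap⁺ oddShapesOf (lose (subsets-complete S)
        (∈-concatMap⁺ _ (lose (∈-filterᵇ⁺ (V.lookup S) (∈-allFin i₀) i₀∈S)
                              (∈-map⁺ (oddShape S i₀) (∈-allFin b₀))))))

deg≤Δ : ∀ {n} (G : Graph n) v → deg G v ≤ Δ G
deg≤Δ G v = ≤-foldr-⊔ (∈-map⁺ (deg G) (∈-allFin v))

module Construction {n : ℕ} (G : Graph n) (side : Fin n → Bool)
                    (bipartite : ∀ u v → adj G u v ≡ true → side u ≢ side v)
                    (c₀ : Fin ⌈ Δ G /2⌉) where

  adj-sym : ∀ {u v} → adj G u v ≡ true → adj G v u ≡ true
  adj-sym {u} {v} uv = trans (Graph.sym G v u) uv

  neighbours : Fin n → List (Fin n)
  neighbours v = filterᵇ (adj G v) (allFin n)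

  ∈-neighbours : ∀ {v u} → adj G v u ≡ true → u ∈ neighbours v
  ∈-neighbours {v} {u} vu = ∈-filterᵇ⁺ (adj G v) (∈-allFin u) vu

  -- The edge vu is attached to the copy ⌊i/2⌋ of v, where u is the i-th
  -- neighbour of v: v has ⌈deg v/2⌉ copies, each with at most two edges.
  index : Fin n → Fin n → ℕ
  index v u = position F._≟_ u (neighbours v)

  copy : Fin n → Fin n → ℕ
  copy v u = ⌊ index v u /2⌋

  copy-< : ∀ {v u} → adj G v u ≡ true → copy v u < ⌈ deg G v /2⌉
  copy-< vu = half-< _ _ (position-< F._≟_ (∈-neighbours vu))

  neighbour-by-copy : ∀ {v u u'} → adj G v u ≡ true → adj G v u' ≡ true → copy v u ≡ copy v u' →
                      parity (index v u) ≡ parity (index v u') → u ≡ u'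
  neighbour-by-copy vu vu' copies parities = position-injective F._≟_ (∈-neighbours vu) (∈-neighbours vu')
    (half-parity-injective _ _ copies parities)

  -- Every edge of G is listed once, as (l , r) with l on the true side.
  Pair : Set
  Pair = Fin n × Fin n

  _≟P_ : DecidableEquality Pair
  _≟P_ = PP.≡-dec F._≟_ F._≟_

  isEdge : Pair → Bool
  isEdge (l , r) = side l ∧ adj G l r

  edges : List Pair
  edges = filterᵇ isEdge (L.cartesianProduct (allFin n) (allFin n))

  ∈-edges⁻ : ∀ {l r} → (l , r) ∈ edges → side l ≡ true × adj G l r ≡ true
  ∈-edges⁻ p∈ = let (_ , lr) = ∈-filterᵇ⁻ isEdge {xs = L.cartesianProduct (allFin n) (allFin n)} p∈ in
    ∧-trueˡ lr , ∧-trueʳ lr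

  orient : Fin n → Fin n → Pair
  orient u v = if side u then (u , v) else (v , u)

  orient-∈ : ∀ {u v} → adj G u v ≡ true → orient u v ∈ edges
  orient-∈ {u} {v} uv with side u in su | side v in sv
  ... | true | _ = ∈-filterᵇ⁺ isEdge (∈-cartesianProduct⁺ (∈-allFin u) (∈-allFin v)) (∧-true su uv)
  ... | false | true = ∈-filterᵇ⁺ isEdge (∈-cartesianProduct⁺ (∈-allFin v) (∈-allFin u)) (∧-true sv (adj-sym uv))
  ... | false | false = ⊥-elim (bipartite u v uv (trans su (sym sv)))

  orient-sym : ∀ {u v} → adj G u v ≡ true → orient u v ≡ orient v u
  orient-sym {u} {v} uv with side u in su | side v in sv
  ... | true | false = refl
  ... | false | true = refl
  ... | true | true = ⊥-elim (bipartite u v uv (trans su (sym sv)))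
  ... | false | false = ⊥-elim (bipartite u v uv (trans su (sym sv)))

  orient-injective : ∀ {u v w} → orient u v ≡ orient u w → v ≡ w
  orient-injective {u} eq with side u
  ... | true = proj₂ (PP.,-injective eq)
  ... | false = proj₁ (PP.,-injective eq)

  orient-true : ∀ {u v} → side u ≡ true → orient u v ≡ (u , v)
  orient-true su = cong (if_then _ else _) su

  orient-false : ∀ {u v} → side u ≡ false → orient u v ≡ (v , u)
  orient-false su = cong (if_then _ else _) su

  -- Stage 1.  Join the copy (l , copy l r) to (r , copy r l) for every edge
  -- (l , r).  Every copy has degree ≤ 2, so this bipartite graph has a proper
  -- 2-edge-colouring: the parity bit of the edges.
  Copy : Set
  Copy = Fin n × ℕ

  _≟C_ : DecidableEquality Copy
  _≟C_ = PP.≡-dec F._≟_ ℕP._≟_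

  copyL copyR : Pair → Copy
  copyL (l , r) = l , copy l r
  copyR (l , r) = r , copy r l

  module Stage1 = Multigraph.Bipartite _≟P_ _≟C_ _≟C_ copyL copyR 2

  -- the edges at a copy are told apart by the parity of their indices
  degreeL : Stage1.SX.DegreeAtMost edges
  degreeL = Stage1.SX.labelling⇒degree (λ (l , r) → parity (index l r))
                                       (λ {(l , r)} _ → parity<2 (index l r)) proper-label
    where
      proper-label : Stage1.SX.Proper edges (λ (l , r) → parity (index l r))
      proper-label {l , r} {l' , r'} p∈ p'∈ same parities with PP.,-injective same
      ... | refl , copies =
        cong (l ,_) (neighbour-by-copy (proj₂ (∈-edges⁻ p∈)) (proj₂ (∈-edges⁻ p'∈)) copies parities)

  degreeR : Stage1.SY.DegreeAtMost edges
  degreeR = Stage1.SY.labelling⇒degree (λ (l , r) → parity (index r l))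
                                       (λ {(l , r)} _ → parity<2 (index r l)) proper-label
    where
      proper-label : Stage1.SY.Proper edges (λ (l , r) → parity (index r l))
      proper-label {l , r} {l' , r'} p∈ p'∈ same parities with PP.,-injective same
      ... | refl , copies =
        cong (_, r) (neighbour-by-copy (adj-sym (proj₂ (∈-edges⁻ p∈))) (adj-sym (proj₂ (∈-edges⁻ p'∈))) copies parities)

  opaque
    parityColouring : ∃ (Stage1.ProperColouring edges)
    parityColouring = Stage1.konig zero edges degreeL degreeR

  bit : Pair → Fin 2
  bit = proj₁ parityColouring

  copy-bit-injective : ∀ {x u u'} → adj G x u ≡ true → adj G x u' ≡ true → copy x u ≡ copy x u' →
                       bit (orient x u) ≡ bit (orient x u') → u ≡ u'
  copy-bit-injective {x} {u} {u'} xu xu' copies bits = orient-injective (by-side (side x) refl)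
    where
      by-side : ∀ t → side x ≡ t → orient x u ≡ orient x u'
      by-side true sx = proj₁ (proj₂ parityColouring) (orient-∈ xu) (orient-∈ xu') same bits
        where
          same : copyL (orient x u) ≡ copyL (orient x u')
          same = trans (cong copyL (orient-true sx)) (trans (cong (x ,_) copies) (cong copyL (sym (orient-true sx))))
      by-side false sx = proj₂ (proj₂ parityColouring) (orient-∈ xu) (orient-∈ xu') same bits
        where
          same : copyR (orient x u) ≡ copyR (orient x u')
          same = trans (cong copyR (orient-false sx)) (trans (cong (x ,_) copies) (cong copyR (sym (orient-false sx))))

  -- Stage 2 has two copies (v , true) and (v , false) of every vertex v: the
  -- edges of v of parity parityAt s (side v) are attached to (v , s), so each
  -- edge joins a true copy to a false copy.
  parityAt : Bool → Bool → Fin 2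
  parityAt true true = zero
  parityAt false false = zero
  parityAt true false = suc zero
  parityAt false true = suc zero

  parityAt-onto : ∀ t b → ∃ λ s → parityAt s t ≡ b
  parityAt-onto true zero = true , refl
  parityAt-onto true (suc zero) = false , refl
  parityAt-onto false zero = false , refl
  parityAt-onto false (suc zero) = true , refl

  endAt : Bool → Pair → Fin n
  endAt s (l , r) = if does (bit (l , r) F.≟ parityAt s true) then l else r

  orient-endAt : ∀ s {v u} → bit (orient v u) ≡ parityAt s (side v) →
                 endAt s (orient v u) ≡ v × endAt (not s) (orient v u) ≡ u
  orient-endAt true {v} {u} b with side v
  ... | true rewrite b = refl , refl
  ... | false rewrite b = refl , refl
  orient-endAt false {v} {u} b with side v
  ... | true rewrite b = refl , refl
  ... | false rewrite b = refl , refl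

  endAt-orient : ∀ s {p} → p ∈ edges → let x = endAt s p ; y = endAt (not s) p in
                 p ≡ orient x y × bit p ≡ parityAt s (side x) × adj G x y ≡ true
  endAt-orient s {l , r} p∈ with ∈-edges⁻ p∈
  ... | sl , lr = by-cases s (bit (l , r)) refl
    where
      sr : side r ≡ false
      sr with side r in sr
      ... | false = refl
      ... | true = ⊥-elim (bipartite l r lr (trans sl (sym sr)))
      by-cases : ∀ s b → bit (l , r) ≡ b → let x = endAt s (l , r) ; y = endAt (not s) (l , r) in
                 (l , r) ≡ orient x y × bit (l , r) ≡ parityAt s (side x) × adj G x y ≡ true
      by-cases true zero b rewrite b = sym (orient-true sl) , sym (cong (parityAt true) sl) , lr
      by-cases true (suc zero) b rewrite b = sym (orient-false sr) , sym (cong (parityAt true) sr) , adj-sym lr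
      by-cases false zero b rewrite b = sym (orient-false sr) , sym (cong (parityAt false) sr) , adj-sym lr
      by-cases false (suc zero) b rewrite b = sym (orient-true sl) , sym (cong (parityAt false) sl) , lr

  -- Every copy of v will carry k colours: ⌈deg v/2⌉ real edges at most, and
  -- pad v dummy edges joining (v , true) to (v , false).
  k : ℕ
  k = ⌈ Δ G /2⌉

  half : Fin n → ℕ
  half v = ⌈ deg G v /2⌉

  half≤k : ∀ v → half v ≤ k
  half≤k v = ℕP.⌈n/2⌉-mono (deg≤Δ G v)

  pad : Fin n → ℕ
  pad v = k ∸ half v

  Dummy : Set
  Dummy = Fin n × ℕ

  dummiesAt : Fin n → List Dummy
  dummiesAt v = map (v ,_) (upTo (pad v))

  dummies : List Dummy
  dummies = concatMap dummiesAt (allFin n)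

  ∈-dummies⁺ : ∀ {v j} → j < pad v → (v , j) ∈ dummies
  ∈-dummies⁺ {v} j<pad = ∈-concatMap⁺ dummiesAt (lose (∈-allFin v) (∈-map⁺ (v ,_) (∈-upTo⁺ j<pad)))

  ∈-dummies⁻ : ∀ {v j} → (v , j) ∈ dummies → j < pad v
  ∈-dummies⁻ d∈ with find (∈-concatMap⁻ dummiesAt {xs = allFin n} d∈)
  ... | v , _ , d∈v with ∈-map⁻ (v ,_) d∈v
  ...   | j , j∈ , refl = ∈-upTo⁻ j∈

  Edge₂ : Set
  Edge₂ = Pair ⊎ Dummy

  _≟E₂_ : DecidableEquality Edge₂
  _≟E₂_ = SP.≡-dec _≟P_ (PP.≡-dec F._≟_ ℕP._≟_)

  end₂ : Bool → Edge₂ → Fin n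
  end₂ s (inj₁ p) = endAt s p
  end₂ s (inj₂ (v , j)) = v

  edges₂ : List Edge₂
  edges₂ = map inj₁ edges ++ map inj₂ dummies

  ∈-edges₂⁻ : ∀ {e} → e ∈ edges₂ →
              (∃ λ p → e ≡ inj₁ p × p ∈ edges) ⊎ (∃ λ ((v , j) : Dummy) → e ≡ inj₂ (v , j) × j < pad v)
  ∈-edges₂⁻ e∈ with ∈-++⁻ (map inj₁ edges) e∈
  ... | inj₁ e∈G = let (p , p∈ , e≡) = ∈-map⁻ inj₁ e∈G in inj₁ (p , e≡ , p∈)
  ... | inj₂ e∈D = let (d , d∈ , e≡) = ∈-map⁻ inj₂ e∈D in inj₂ (d , e≡ , ∈-dummies⁻ d∈)

  -- the bipartite multigraph of stage 2, with the copies s of vertices as side s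
  module Side₂ (s : Bool) = Multigraph.Side _≟E₂_ F._≟_ (end₂ s) k
  module Stage2 = Multigraph.Bipartite _≟E₂_ F._≟_ F._≟_ (end₂ true) (end₂ false) k

  -- Numbering of the edges at a stage-2 copy of x: real edges by their copy of
  -- x (below half x), dummies from half x on.
  slot : Bool → Edge₂ → ℕ
  slot s (inj₁ p) = copy (endAt s p) (endAt (not s) p)
  slot s (inj₂ (v , j)) = half v + j

  slot-real-< : ∀ s {p} → p ∈ edges → slot s (inj₁ p) < half (endAt s p)
  slot-real-< s p∈ = copy-< (proj₂ (proj₂ (endAt-orient s p∈)))

  slot-< : ∀ s {e} → e ∈ edges₂ → slot s e < k
  slot-< s e∈ with ∈-edges₂⁻ e∈
  ... | inj₁ (p , refl , p∈) = ℕP.<-≤-trans (slot-real-< s p∈) (half≤k _)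
  ... | inj₂ ((v , j) , refl , j<pad) =
    ℕP.<-≤-trans (ℕP.+-monoʳ-< (half v) j<pad) (ℕP.≤-reflexive (ℕP.m+[n∸m]≡n (half≤k v)))

  same-slot : ∀ s {p p'} → p ∈ edges → p' ∈ edges → endAt s p ≡ endAt s p' →
              slot s (inj₁ p) ≡ slot s (inj₁ p') → p ≡ p'
  same-slot s p∈ p'∈ = coincide (endAt-orient s p∈) (endAt-orient s p'∈)
    where
      coincide : ∀ {p p' x y x' y'} → p ≡ orient x y × bit p ≡ parityAt s (side x) × adj G x y ≡ true →
                 p' ≡ orient x' y' × bit p' ≡ parityAt s (side x') × adj G x' y' ≡ true →
                 x ≡ x' → copy x y ≡ copy x' y' → p ≡ p'
      coincide (refl , bit-p , xy) (refl , bit-p' , xy') refl copies =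
        cong (orient _) (copy-bit-injective xy xy' copies (trans bit-p (sym bit-p')))

  real-below-dummy : ∀ s {p v j} → p ∈ edges → endAt s p ≡ v → slot s (inj₁ p) ≢ half v + j
  real-below-dummy s {j = j} p∈ refl eq = ℕP.<-irrefl eq (ℕP.<-≤-trans (slot-real-< s p∈) (ℕP.m≤m+n _ j))

  -- distinct edges at a copy have distinct slots, so copies have degree ≤ k
  slot-proper : ∀ s → Side₂.Proper s edges₂ (slot s)
  slot-proper s e∈ e'∈ same slots with ∈-edges₂⁻ e∈ | ∈-edges₂⁻ e'∈
  ... | inj₁ (p , refl , p∈) | inj₁ (p' , refl , p'∈) = cong inj₁ (same-slot s p∈ p'∈ same slots)
  ... | inj₁ (p , refl , p∈) | inj₂ (_ , refl , _) = ⊥-elim (real-below-dummy s p∈ same slots)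
  ... | inj₂ (_ , refl , _) | inj₁ (p , refl , p∈) = ⊥-elim (real-below-dummy s p∈ (sym same) (sym slots))
  ... | inj₂ ((v , j) , refl , _) | inj₂ ((v' , j') , refl , _) with refl ← same =
    cong (λ j → inj₂ (v , j)) (ℕP.+-cancelˡ-≡ (half v) j j' slots)

  opaque
    colouring₂ : ∃ (Stage2.ProperColouring edges₂)
    colouring₂ = Stage2.konig c₀ edges₂ (degree₂ true) (degree₂ false)
      where
        degree₂ : ∀ s → Side₂.DegreeAtMost s edges₂
        degree₂ s = Side₂.labelling⇒degree s (slot s) (slot-< s) (slot-proper s)

  colour₂ : Edge₂ → Fin k
  colour₂ = proj₁ colouring₂

  proper₂ : ∀ s → Side₂.Proper s edges₂ colour₂
  proper₂ true = proj₁ (proj₂ colouring₂)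
  proper₂ false = proj₂ (proj₂ colouring₂)

  real∈edges₂ : ∀ {v u} → adj G v u ≡ true → inj₁ (orient v u) ∈ edges₂
  real∈edges₂ vu = ∈-++⁺ˡ (∈-map⁺ inj₁ (orient-∈ vu))

  dummy∈edges₂ : ∀ {v j} → j < pad v → inj₂ (v , j) ∈ edges₂
  dummy∈edges₂ j<pad = ∈-++⁺ʳ (map inj₁ edges) (∈-map⁺ inj₂ (∈-dummies⁺ j<pad))

  copyFor : Fin n → Fin 2 → Bool
  copyFor v b = proj₁ (parityAt-onto (side v) b)

  at-copyFor : ∀ {v u b} → bit (orient v u) ≡ b →
               endAt (copyFor v b) (orient v u) ≡ v × endAt (not (copyFor v b)) (orient v u) ≡ u
  at-copyFor {v} {u} {b} bit≡b = orient-endAt (copyFor v b) (trans bit≡b (sym (proj₂ (parityAt-onto (side v) b))))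

  colourAt : Fin n → Fin n → Fin k
  colourAt v u = colour₂ (inj₁ (orient v u))

  colourAt-injective : ∀ {v u w b} → adj G v u ≡ true → adj G v w ≡ true →
                       bit (orient v u) ≡ b → bit (orient v w) ≡ b →
                       colourAt v u ≡ colourAt v w → u ≡ w
  colourAt-injective {v} {u} {w} {b} vu vw bu bw eq = orient-injective (SP.inj₁-injective
    (proper₂ (copyFor v b) (real∈edges₂ vu) (real∈edges₂ vw)
             (trans (proj₁ (at-copyFor bu)) (sym (proj₁ (at-copyFor bw)))) eq))

  colour : Fin n → Fin n → Fin (k * 2)
  colour u v = F.combine (colourAt u v) (bit (orient u v))

  φ : ProperEdgeColoring G (k * 2)
  φ = record
    { col = colour
    ; colSym = λ u v uv → cong (λ p → F.combine (colour₂ (inj₁ p)) (bit p)) (orient-sym uv)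
    ; proper = λ v u w vu vw eq → let (same-colour , same-bit) = FP.combine-injective _ _ _ _ eq in
        colourAt-injective vu vw same-bit refl same-colour
    }

  open Shapes k using (Palette; split; shape; shape-cong; evenShape; oddShape; candidates; candidates-length;
                      evenShape-candidate; oddShape-candidate)

  module AtVertex (v : Fin n) where

    nbrs : Fin 2 → List (Fin n)
    nbrs b = filterᵇ (λ u → does (bit (orient v u) F.≟ b)) (neighbours v)

    ∈-nbrs⁺ : ∀ {u b} → adj G v u ≡ true → bit (orient v u) ≡ b → u ∈ nbrs b
    ∈-nbrs⁺ {u} {b} vu bu = ∈-filterᵇ⁺ _ (∈-neighbours vu) (dec-true (bit (orient v u) F.≟ b) bu)

    ∈-nbrs⁻ : ∀ {u b} → u ∈ nbrs b → adj G v u ≡ true × bit (orient v u) ≡ b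
    ∈-nbrs⁻ {u} {b} u∈ =
      let (u∈N , bu) = ∈-filterᵇ⁻ _ {xs = neighbours v} u∈
          (_ , vu) = ∈-filterᵇ⁻ (adj G v) {xs = allFin n} u∈N
      in vu , does-true (bit (orient v u) F.≟ b) bu

    unique-nbrs : ∀ b → Unique (nbrs b)
    unique-nbrs b = UP.filter⁺ _ (UP.filter⁺ _ (UP.allFin⁺ n))

    -- at most half v of them, as they are attached to distinct copies of v
    nbrs-≤ : ∀ b → length (nbrs b) ≤ half v
    nbrs-≤ b = unique-bounded (copy v) (unique-nbrs b) (λ u∈ → copy-< (proj₁ (∈-nbrs⁻ u∈)))
      λ u∈ w∈ copies → copy-bit-injective (proj₁ (∈-nbrs⁻ u∈)) (proj₁ (∈-nbrs⁻ w∈)) copies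
                                          (trans (proj₂ (∈-nbrs⁻ u∈)) (sym (proj₂ (∈-nbrs⁻ w∈))))

    nbrs-sum : length (nbrs zero) + length (nbrs (suc zero)) ≡ deg G v
    nbrs-sum = partition-length (λ u → bit (orient v u)) (neighbours v)

    coloursOf : Fin 2 → List (Fin k)
    coloursOf b = map (colourAt v) (nbrs b)

    dummyColour : ℕ → Fin k
    dummyColour j = colour₂ (inj₂ (v , j))

    dummyColours : List (Fin k)
    dummyColours = map dummyColour (upTo (pad v))

    length-coloursOf : ∀ b → length (coloursOf b) ≡ length (nbrs b)
    length-coloursOf b = LP.length-map (colourAt v) (nbrs b)

    unique-coloursOf : ∀ b → Unique (coloursOf b)
    unique-coloursOf b = unique-map (colourAt v) (unique-nbrs b) λ u∈ w∈ →
      colourAt-injective (proj₁ (∈-nbrs⁻ u∈)) (proj₁ (∈-nbrs⁻ w∈)) (proj₂ (∈-nbrs⁻ u∈)) (proj₂ (∈-nbrs⁻ w∈))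

    unique-dummyColours : Unique dummyColours
    unique-dummyColours = unique-map dummyColour (UP.upTo⁺ (pad v)) λ j∈ j'∈ eq →
      cong proj₂ (SP.inj₂-injective
        (proper₂ true (dummy∈edges₂ (∈-upTo⁻ j∈)) (dummy∈edges₂ (∈-upTo⁻ j'∈)) refl eq))

    disjoint : ∀ b → Disjoint (coloursOf b) dummyColours
    disjoint b (i∈ , i∈D) with ∈-map⁻ (colourAt v) i∈ | ∈-map⁻ dummyColour i∈D
    ... | u , u∈ , refl | j , j∈ , eq
      with proper₂ (copyFor v b) (real∈edges₂ (proj₁ (∈-nbrs⁻ u∈))) (dummy∈edges₂ (∈-upTo⁻ j∈))
                   (proj₁ (at-copyFor (proj₂ (∈-nbrs⁻ u∈)))) eq
    ... | ()

    full : ∀ b → length (nbrs b) ≡ half v → ∀ i → i ∈ coloursOf b ⊎ i ∈ dummyColours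
    full b len = cover (unique-coloursOf b) unique-dummyColours (disjoint b) (begin
      length (coloursOf b) + length dummyColours ≡⟨ cong₂ _+_ (length-coloursOf b) (LP.length-map _ (upTo (pad v))) ⟩
      length (nbrs b) + length (upTo (pad v))      ≡⟨ cong₂ _+_ len (LP.length-upTo (pad v)) ⟩
      half v + (k ∸ half v)                        ≡⟨ ℕP.m+[n∸m]≡n (half≤k v) ⟩
      k                                            ∎)
      where open ≡-Reasoning

    ⊆full : ∀ b b' → length (nbrs b) ≡ half v → ∀ {i} → i ∈ coloursOf b' → i ∈ coloursOf b
    ⊆full b b' len {i} i∈ with full b len i
    ... | inj₁ i∈b = i∈b
    ... | inj₂ i∈D = ⊥-elim (disjoint b' (i∈ , i∈D))

    palette-shape : palette G φ v ≡ shape (λ i b → member i (coloursOf b))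
    palette-shape = VP.tabulate-cong λ c → bool-ext (present⇒member c) (member⇒present c)
      where
        present⇒member : ∀ c → any (λ u → adj G v u ∧ ⌊ colour v u F.≟ c ⌋) (allFin n) ≡ true →
                         member (proj₁ (split c)) (coloursOf (proj₂ (split c))) ≡ true
        present⇒member c present with any-true⁻ _ (allFin n) present
        ... | u , _ , vu∧colour = subst (λ (i , b) → member i (coloursOf b) ≡ true) (sym split≡)
                (member⁺ (∈-map⁺ (colourAt v) (∈-nbrs⁺ (∧-trueˡ vu∧colour) refl)))
          where
            colour≡c : colour v u ≡ c
            colour≡c = does-true (colour v u F.≟ c) (trans (sym (isYes≗does _)) (∧-trueʳ vu∧colour))
            split≡ : split c ≡ (colourAt v u , bit (orient v u))
            split≡ = trans (cong split (sym colour≡c)) (FP.remQuot-combine _ _)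
        member⇒present : ∀ c → member (proj₁ (split c)) (coloursOf (proj₂ (split c))) ≡ true →
                         any (λ u → adj G v u ∧ ⌊ colour v u F.≟ c ⌋) (allFin n) ≡ true
        member⇒present c i∈ with ∈-map⁻ (colourAt v) (member⁻ i∈)
        ... | u , u∈ , i≡ =
          any-true⁺ _ (∈-allFin u) (∧-true vu (trans (isYes≗does _) (dec-true (colour v u F.≟ c) colour≡c)))
          where
            vu : adj G v u ≡ true
            vu = proj₁ (∈-nbrs⁻ u∈)
            colour≡c : colour v u ≡ c
            colour≡c = trans (cong₂ F.combine (sym i≡) (proj₂ (∈-nbrs⁻ u∈))) (FP.combine-remQuot {k} 2 c)

    -- Even degree: both parity classes have the colours of the complement
    -- of the dummy colours, so the palette is S × Fin 2.
    even-palette : isOdd (deg G v) ≡ false → palette G φ v ∈ candidates (deg G v)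
    even-palette even = subst (_∈ candidates (deg G v)) (sym palette≡) (evenShape-candidate {S = S} even size)
      where
        halves : ⌊ deg G v /2⌋ * 2 ≡ deg G v × ⌊ deg G v /2⌋ ≡ ⌈ deg G v /2⌉
        halves = even-half (deg G v) even
        lengths : length (nbrs zero) ≡ half v × length (nbrs (suc zero)) ≡ half v
        lengths = split-even (half v) (nbrs-≤ zero) (nbrs-≤ (suc zero))
          (trans nbrs-sum (trans (sym (proj₁ halves)) (cong (_* 2) (proj₂ halves))))
        S : Subset k
        S = indicator (coloursOf zero)
        same : ∀ i b → member i (coloursOf b) ≡ V.lookup S i
        same i zero = sym (VP.lookup∘tabulate _ i)
        same i (suc zero) = trans (bool-ext (member-⊆ (⊆full zero (suc zero) (proj₁ lengths)))
                                            (member-⊆ (⊆full (suc zero) zero (proj₂ lengths))))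
                                  (sym (VP.lookup∘tabulate _ i))
        palette≡ : palette G φ v ≡ evenShape S
        palette≡ = trans palette-shape (shape-cong same)
        size : ∣ S ∣ ≡ ⌊ deg G v /2⌋
        size = trans (indicator-size (unique-coloursOf zero))
                     (trans (length-coloursOf zero) (trans (proj₁ lengths) (sym (proj₂ halves))))

    -- Odd degree, with the class bF of size half v and the other class one
    -- smaller: the palette is S × Fin 2 without one colour (i₀ , other bF).
    odd-palette : ∀ bF → isOdd (deg G v) ≡ true → length (nbrs bF) ≡ half v →
                  suc (length (nbrs (other bF))) ≡ half v → palette G φ v ∈ candidates (deg G v)
    odd-palette bF odd lenF lenN
      with one-more F._≟_ (unique-coloursOf bF) (unique-coloursOf (other bF)) (⊆full bF (other bF) lenF)
             (trans (length-coloursOf bF) (trans lenF (sym (trans (cong suc (length-coloursOf (other bF))) lenN))))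
    ... | i₀ , i₀∈ , i₀∉ , only = subst (_∈ candidates (deg G v)) (sym palette≡)
      (oddShape-candidate {S = S} {i₀ = i₀} bN odd size (trans (lookup-S i₀) (member⁺ i₀∈)))
      where
        bN : Fin 2
        bN = other bF
        S : Subset k
        S = indicator (coloursOf bF)
        lookup-S : ∀ i → V.lookup S i ≡ member i (coloursOf bF)
        lookup-S i = VP.lookup∘tabulate _ i
        same : ∀ i b → member i (coloursOf b) ≡ V.lookup S i ∧ not (does (i F.≟ i₀) ∧ does (b F.≟ bN))
        same i b with fin2-cases bF b
        ... | inj₁ refl rewrite dec-false (bF F.≟ bN) (other-≢ bF ∘ sym) | BP.∧-zeroʳ (does (i F.≟ i₀)) =
          sym (trans (BP.∧-identityʳ _) (lookup-S i))
        ... | inj₂ refl rewrite dec-true (bN F.≟ bN) refl with i F.≟ i₀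
        ...   | yes refl = trans (member-∉ i₀∉) (sym (BP.∧-zeroʳ _))
        ...   | no i≢i₀ = trans (bool-ext (member-⊆ (⊆full bF bN lenF))
                                          (λ i∈ → member⁺ (only (member⁻ i∈) i≢i₀)))
                                (sym (trans (BP.∧-identityʳ _) (lookup-S i)))
        palette≡ : palette G φ v ≡ oddShape S i₀ bN
        palette≡ = trans palette-shape (shape-cong same)
        size : ∣ S ∣ ≡ ⌊ suc (deg G v) /2⌋
        size = trans (indicator-size (unique-coloursOf bF)) (trans (length-coloursOf bF) lenF)

    palette-candidate : palette G φ v ∈ candidates (deg G v)
    palette-candidate = by-parity (isOdd (deg G v)) refl
      where
        by-parity : ∀ o → isOdd (deg G v) ≡ o → palette G φ v ∈ candidates (deg G v)
        by-parity false even = even-palette even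
        by-parity true odd with split-odd (half v) (nbrs-≤ zero) (nbrs-≤ (suc zero))
                                (trans (cong suc nbrs-sum) (sym (odd-half (deg G v) odd)))
        ... | inj₁ (len₀ , len₁) = odd-palette zero odd len₀ len₁
        ... | inj₂ (len₁ , len₀) = odd-palette (suc zero) odd len₁ len₀

  occurring : ℕ → List Palette
  occurring d = if occurs G d then candidates d else []

  allCandidates : List Palette
  allCandidates = concatMap occurring (upTo (suc (Δ G)))

  allCandidates-length : length allCandidates ≡ paletteBound G
  allCandidates-length =
    trans (length-concatMap occurring (upTo (suc (Δ G)))) (cong sum (LP.map-cong count (upTo (suc (Δ G)))))
    where
      count : ∀ d → length (occurring d) ≡ (if occurs G d then term G d else 0)
      count d with occurs G d
      ... | true = candidates-length d
      ... | false = refl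

  occurs-deg : ∀ v → occurs G (deg G v) ≡ true
  occurs-deg v = any-true⁺ _ (∈-allFin v) (Equivalence.to T-≡ (ℕP.≡⇒≡ᵇ (deg G v) (deg G v) refl))

  palette∈allCandidates : ∀ v → palette G φ v ∈ allCandidates
  palette∈allCandidates v = ∈-concatMap⁺ occurring (lose (∈-upTo⁺ (s≤s (deg≤Δ G v)))
    (subst (λ o → palette G φ v ∈ (if o then candidates (deg G v) else [])) (sym (occurs-deg v))
           (AtVertex.palette-candidate v)))

  palette-index : PaletteIndex≤ G (paletteBound G)
  palette-index = k * 2 , φ , ℕP.≤-trans (unique-⊆-length (UDP.deduplicate-! (VP.≡-dec BP._≟_) palettes) ⊆candidates)
                                         (ℕP.≤-reflexive allCandidates-length)
    where
      palettes : List Palette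
      palettes = map (palette G φ) (allFin n)
      ⊆candidates : ∀ {P} → P ∈ deduplicate (VP.≡-dec BP._≟_) palettes → P ∈ allCandidates
      ⊆candidates P∈ with ∈-map⁻ (palette G φ) (∈-deduplicate⁻ (VP.≡-dec BP._≟_) palettes P∈)
      ... | v , _ , refl = palette∈allCandidates v

-- Corollary 2.3.  (The hypothesis on isolated vertices only serves to
-- provide a colour, i.e. ⌈Δ/2⌉ ≥ 1, when G has a vertex.)
corollary2p3 : (n : ℕ) (G : Graph n) → Bipartite G → NoIsolatedVertices G →
    PaletteIndex≤ G (paletteBound G)
-- (The graph without vertices is coloured with no colours at all.)
corollary2p3 zero G _ _ = 0 , record { col = λ () ; colSym = λ () ; proper = λ () } , z≤n
corollary2p3 (suc n) G (side , bipartite) no-isolated = Construction.palette-index G side bipartite c₀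
  where
    Δ≥1 : 1 ≤ Δ G
    Δ≥1 = ℕP.≤-trans (∈-length (∈-filterᵇ⁺ (adj G zero) (∈-allFin _) (proj₂ (no-isolated zero))))
                     (deg≤Δ G zero)
    c₀ : Fin ⌈ Δ G /2⌉
    c₀ = F.fromℕ< (ℕP.⌈n/2⌉-mono Δ≥1)
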